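{- Let $L$ be the implicational propositional calculus, let $Q$ be a well-formed formula that is not a theorem of $L$, and for a well-formed formula $A$ write $QA := A\supset Q$. Let $N$ be an extension of $L$ such that $Q\notin \mathbb{T}(N)$ and, for every well-formed formula $A$, either $QQA\in\mathbb{T}(N)$ or $QA\in\mathbb{T}(N)$. Then for every well-formed formula $A$ exactly one of $QQA$, $QA$ lies in $\mathbb{T}(N)$, and the function $v_N$ from well-formed formulas to $\{0,1\}$ defined by $v_N(A)=1$ if $QQA\in\mathbb{T}(N)$ and $v_N(A)=0$ if $QA\in\mathbb{T}(N)$ is a valuation: for all well-formed formulas $A,B$, $v_N(A\supset B)=0$ if and only if $v_N(A)=1$ and $v_N(B)=0$.
   Context: The implicational propositional calculus $L$ has propositional variables, $\supset$ as its only connective, modus ponens as its only inference rule, and the axiom schemes $A \supset (B \supset A)$, $[A \supset (B \supset C)] \supset [(A \supset B) \supset (A \supset C)]$, and $[(A \supset B) \supset A] \supset A$. An extension of $L$ is obtained by adding well-formed formulas as extra axioms (modus ponens remains the only rule); $\mathbb{T}(N)$ denotes the set of theorems of the system $N$. A valuation is a map $v$ from well-formed formulas to $\{0,1\}$ with $v(A\supset B)=0$ precisely when $v(A)=1$ and $v(B)=0$. -}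

module Defs where

open import Data.Nat using (ℕ)
open import Data.Bool using (Bool; true; false)
open import Data.Product using (_×_)
open import Relation.Binary.PropositionalEquality using (_≡_)
open import Function.Bundles using (_⇔_)

data Formula : Set where
  var : ℕ → Formula
  _⊃_ : Formula → Formula → Formula

infixr 5 _⊃_

-- Theorems of the extension N of L whose extra axioms are the formulas
-- satisfying Ax (an arbitrary set of wffs).  Modus ponens is the only rule.
data Thm (Ax : Formula → Set) : Formula → Set where
  ax1 : ∀ A B → Thm Ax (A ⊃ (B ⊃ A))
  ax2 : ∀ A B C → Thm Ax ((A ⊃ (B ⊃ C)) ⊃ ((A ⊃ B) ⊃ (A ⊃ C)))
  ax3 : ∀ A B → Thm Ax (((A ⊃ B) ⊃ A) ⊃ A)
  extra : ∀ A → Ax A → Thm Ax A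
  mp : ∀ {A B} → Thm Ax A → Thm Ax (A ⊃ B) → Thm Ax B

data NoAx : Formula → Set where

ThmL : Formula → Set
ThmL = Thm NoAx

IsValuation : (Formula → Bool) → Set
IsValuation v = ∀ A B → (v (A ⊃ B) ≡ false) ⇔ ((v A ≡ true) × (v B ≡ false))

-- Write QA (below: ∼ A) for A ⊃ Q.  By the deduction theorem, in every extension
-- of L the theorems QQA and QB give Q(A ⊃ B), and together with Q(A ⊃ B) either
-- QA or QQB gives Q (the former through Peirce's law).  Since Q is not a
-- theorem of N, QQA and QA cannot both be theorems (modus ponens would give Q),
-- so the hypothesis makes v_N well defined, and the three derived rules are
-- exactly the truth table of ⊃.
module Submission where

open import Defs
open import Data.Bool using (Bool; true; false)
open import Data.Bool.Properties using (¬-not)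
open import Data.Product using (_×_; Σ; _,_; proj₁; proj₂)
open import Data.Sum using (_⊎_; inj₁; inj₂)
open import Data.Empty using (⊥-elim)
open import Data.List using (List; []; _∷_)
open import Data.List.Membership.Propositional using (_∈_)
open import Data.List.Relation.Unary.Any using (here; there)
open import Level using (Level)
open import Relation.Nullary using (¬_)
open import Relation.Binary.PropositionalEquality using (_≡_; refl)
open import Function.Bundles using (_⇔_; mk⇔; Equivalence)

module _ {a b : Level} {P : Set a} {R : Set b} where

  isInj₁ : P ⊎ R → Bool
  isInj₁ (inj₁ _) = true
  isInj₁ (inj₂ _) = false

  isInj₁≡true⇔ : ¬ (P × R) → (s : P ⊎ R) → (isInj₁ s ≡ true ⇔ P)
  isInj₁≡true⇔ exclusive (inj₁ p) = mk⇔ (λ _ → p) (λ _ → refl)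
  isInj₁≡true⇔ exclusive (inj₂ r) = mk⇔ (λ ()) (λ p → ⊥-elim (exclusive (p , r)))

  isInj₁≡false⇔ : ¬ (P × R) → (s : P ⊎ R) → (isInj₁ s ≡ false ⇔ R)
  isInj₁≡false⇔ exclusive (inj₁ p) = mk⇔ (λ ()) (λ r → ⊥-elim (exclusive (p , r)))
  isInj₁≡false⇔ exclusive (inj₂ r) = mk⇔ (λ _ → r) (λ _ → refl)

module Deduction (Ax : Formula → Set) where

  infix 4 _⊢_

  data _⊢_ (Γ : List Formula) : Formula → Set where
    hyp  : ∀ {A} → A ∈ Γ → Γ ⊢ A
    thm  : ∀ {A} → Thm Ax A → Γ ⊢ A
    ⊢-mp : ∀ {A B} → Γ ⊢ A → Γ ⊢ A ⊃ B → Γ ⊢ B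

  #0 : ∀ {Γ A} → A ∷ Γ ⊢ A
  #0 = hyp (here refl)

  #1 : ∀ {Γ A B} → A ∷ B ∷ Γ ⊢ B
  #1 = hyp (there (here refl))

  ⊃-refl : ∀ A → Thm Ax (A ⊃ A)
  ⊃-refl A = mp (ax1 A A) (mp (ax1 A (A ⊃ A)) (ax2 A (A ⊃ A) A))

  deduction : ∀ {Γ A B} → A ∷ Γ ⊢ B → Γ ⊢ A ⊃ B
  deduction {A = A} (hyp (here refl)) = thm (⊃-refl A)
  deduction {A = A} (hyp (there B∈Γ)) = ⊢-mp (hyp B∈Γ) (thm (ax1 _ A))
  deduction {A = A} (thm ⊢B)          = ⊢-mp (thm ⊢B) (thm (ax1 _ A))
  deduction {A = A} {B} (⊢-mp {C} ⊢C ⊢C⊃B) =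
    ⊢-mp (deduction ⊢C) (⊢-mp (deduction ⊢C⊃B) (thm (ax2 A C B)))

  []⊢⇒Thm : ∀ {A} → [] ⊢ A → Thm Ax A
  []⊢⇒Thm (thm ⊢A)       = ⊢A
  []⊢⇒Thm (⊢-mp ⊢A ⊢A⊃B) = mp ([]⊢⇒Thm ⊢A) ([]⊢⇒Thm ⊢A⊃B)

module RelativeNegation (Ax : Formula → Set) (Q : Formula) where
  open Deduction Ax

  ∼_ : Formula → Formula
  ∼ A = A ⊃ Q

  infix 6 ∼_

  ∼∼-∼⇒∼⊃ : ∀ {A B} → Thm Ax (∼ ∼ A) → Thm Ax (∼ B) → Thm Ax (∼ (A ⊃ B))
  ∼∼-∼⇒∼⊃ ⊢∼∼A ⊢∼B =
    []⊢⇒Thm (deduction (⊢-mp (deduction (⊢-mp (⊢-mp #0 #1) (thm ⊢∼B))) (thm ⊢∼∼A)))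

  -- Assuming Q ⊃ B, the hypothesis ∼ A gives A ⊃ B, hence Q; Peirce's law
  -- ((Q ⊃ B) ⊃ Q) ⊃ Q then discharges the assumption.
  ∼-∼⊃⇒Q : ∀ {A B} → Thm Ax (∼ A) → Thm Ax (∼ (A ⊃ B)) → Thm Ax Q
  ∼-∼⊃⇒Q {A} {B} ⊢∼A ⊢∼A⊃B =
    mp ([]⊢⇒Thm (deduction (⊢-mp (deduction (⊢-mp (⊢-mp #0 (thm ⊢∼A)) #1)) (thm ⊢∼A⊃B))))
       (ax3 Q B)

  ∼∼-∼⊃⇒Q : ∀ {A B} → Thm Ax (∼ ∼ B) → Thm Ax (∼ (A ⊃ B)) → Thm Ax Q
  ∼∼-∼⊃⇒Q {A} {B} ⊢∼∼B ⊢∼A⊃B =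
    mp ([]⊢⇒Thm (deduction (⊢-mp (⊢-mp #0 (thm (ax1 B A))) (thm ⊢∼A⊃B)))) ⊢∼∼B

  ¬Q⇒¬[∼∼×∼] : ¬ Thm Ax Q → ∀ A → ¬ (Thm Ax (∼ ∼ A) × Thm Ax (∼ A))
  ¬Q⇒¬[∼∼×∼] ∤Q A (⊢∼∼A , ⊢∼A) = ∤Q (mp ⊢∼A ⊢∼∼A)

  Tracks : (Formula → Bool) → Set
  Tracks v = ∀ A → (v A ≡ true ⇔ Thm Ax (∼ ∼ A)) × (v A ≡ false ⇔ Thm Ax (∼ A))

  tracks⇒isValuation : ¬ Thm Ax Q → ∀ v → Tracks v → IsValuation v
  tracks⇒isValuation ∤Q v tracks A B = mk⇔ refuted⇒ ⇒refuted
    where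
    true⇒∼∼ : ∀ C → v C ≡ true → Thm Ax (∼ ∼ C)
    true⇒∼∼ C = Equivalence.to (proj₁ (tracks C))

    false⇒∼ : ∀ C → v C ≡ false → Thm Ax (∼ C)
    false⇒∼ C = Equivalence.to (proj₂ (tracks C))

    ∼⇒false : ∀ C → Thm Ax (∼ C) → v C ≡ false
    ∼⇒false C = Equivalence.from (proj₂ (tracks C))

    refuted⇒ : v (A ⊃ B) ≡ false → v A ≡ true × v B ≡ false
    refuted⇒ vA⊃B≡false =
        ¬-not (λ vA≡false → ∤Q (∼-∼⊃⇒Q (false⇒∼ A vA≡false) ⊢∼A⊃B))
      , ¬-not (λ vB≡true → ∤Q (∼∼-∼⊃⇒Q (true⇒∼∼ B vB≡true) ⊢∼A⊃B))
      where
      ⊢∼A⊃B : Thm Ax (∼ (A ⊃ B))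
      ⊢∼A⊃B = false⇒∼ (A ⊃ B) vA⊃B≡false

    ⇒refuted : v A ≡ true × v B ≡ false → v (A ⊃ B) ≡ false
    ⇒refuted (vA≡true , vB≡false) =
      ∼⇒false (A ⊃ B) (∼∼-∼⇒∼⊃ (true⇒∼∼ A vA≡true) (false⇒∼ B vB≡false))

mainTheorem4 : (Q : Formula) → ¬ ThmL Q →
    (Ax : Formula → Set) → ¬ Thm Ax Q →
    ((A : Formula) → Thm Ax ((A ⊃ Q) ⊃ Q) ⊎ Thm Ax (A ⊃ Q)) →
    ((A : Formula) → ¬ (Thm Ax ((A ⊃ Q) ⊃ Q) × Thm Ax (A ⊃ Q)))
    × Σ (Formula → Bool) (λ v →
        ((A : Formula) → ((v A ≡ true) ⇔ Thm Ax ((A ⊃ Q) ⊃ Q))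
                       × ((v A ≡ false) ⇔ Thm Ax (A ⊃ Q)))
        × IsValuation v)
mainTheorem4 Q _ Ax ∤Q decided =
  exclusive , v , tracks , tracks⇒isValuation ∤Q v tracks
  where
  open RelativeNegation Ax Q

  exclusive : ∀ A → ¬ (Thm Ax (∼ ∼ A) × Thm Ax (∼ A))
  exclusive = ¬Q⇒¬[∼∼×∼] ∤Q

  v : Formula → Bool
  v A = isInj₁ (decided A)

  tracks : Tracks v
  tracks A = isInj₁≡true⇔ (exclusive A) (decided A) , isInj₁≡false⇔ (exclusive A) (decided A)
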